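{- Fix an integer $k\ge 4$ and suppose there exists a counterexample for $k$. Then every bad graph is $k$-critical.
   Context: Graphs are finite, simple, undirected; $P_H(k)$ is the number of proper $k$-colorings of $H$; the $2$-core of $H$ is obtained by repeatedly deleting vertices of degree at most one. A counterexample for $k$ is a connected graph $H$ with $\chi(H)=k$ such that either $P_H(k)>k!(k-1)^{|V(H)|-k}$, or $P_H(k)=k!(k-1)^{|V(H)|-k}$ and the $2$-core of $H$ is not a $k$-clique. Let $n$ be the minimum number of vertices of a counterexample for $k$. A graph $G$ is bad if it is a counterexample for $k$ with exactly $n$ vertices and no proper subgraph of $G$ is a counterexample for $k$ (i.e. $G$ is a minimal counterexample). A graph is $k$-critical if it has chromatic number $k$ and deleting any vertex or edge reduces its chromatic number. -}

module Defs where

open import Data.Nat using (ℕ; zero; suc; _∸_; _^_; _<_; _≤_; _>_; _!; _*_)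
open import Data.Bool using (Bool; true; false; _∧_; _∨_; not)
open import Data.Bool.Properties using (∧-comm; ∨-comm)
open import Data.Fin using (Fin; punchIn)
open import Data.Fin.Properties using (all?) renaming (_≟_ to _≟ᶠ_)
open import Data.Fin.Subset using (Subset; _∈_; _∩_; ∣_∣; ⊤; inside; outside)
open import Data.Vec using (Vec; []; _∷_; lookup; tabulate; _[_]≔_)
open import Data.List using (List; []; _∷_; [_]; concatMap; map; length; filter)
open import Data.List.Base using (allFin)
open import Data.Product using (Σ; ∃; _×_; _,_)
open import Data.Sum using (_⊎_)
open import Data.Unit using () renaming (⊤ to Unit)
open import Function using (_∘_)
open import Function.Definitions using (Injective)
open import Relation.Nullary using (¬_; Dec)
open import Relation.Nullary.Decidable using (⌊_⌋; _→-dec_; ¬?)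
open import Relation.Binary.PropositionalEquality using (_≡_; _≢_; refl; cong; cong₂)
import Data.Bool.Properties as BP

record Graph (n : ℕ) : Set where
  field
    adj    : Fin n → Fin n → Bool
    sym    : ∀ i j → adj i j ≡ adj j i
    irrefl : ∀ i → adj i i ≡ false
open Graph public

Proper : ∀ {n} (H : Graph n) {k : ℕ} → (Fin n → Fin k) → Set
Proper H c = ∀ i j → adj H i j ≡ true → c i ≢ c j

proper? : ∀ {n} (H : Graph n) {k : ℕ} (c : Fin n → Fin k) → Dec (Proper H c)
proper? H c = all? λ i → all? λ j →
  (BP._≟_ (adj H i j) true) →-dec (¬? (c i ≟ᶠ c j))

allVecs : (k n : ℕ) → List (Vec (Fin k) n)
allVecs k zero    = [ [] ]
allVecs k (suc n) = concatMap (λ v → map (_∷ v) (allFin k)) (allVecs k n)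

chromPoly : ∀ {n} → Graph n → ℕ → ℕ
chromPoly H k = length (filter (λ v → proper? H (lookup v)) (allVecs k _))

Colorable : ∀ {n} → Graph n → ℕ → Set
Colorable {n} H k = Σ (Fin n → Fin k) (Proper H)

HasChromaticNumber : ∀ {n} → Graph n → ℕ → Set
HasChromaticNumber H k = Colorable H k × (∀ j → j < k → ¬ Colorable H j)

data Reach {n} (H : Graph n) : Fin n → Fin n → Set where
  here : ∀ {u} → Reach H u u
  step : ∀ {u v w} → adj H u v ≡ true → Reach H v w → Reach H u w

Connected : ∀ {n} → Graph n → Set
Connected {n} H = ∀ (u v : Fin n) → Reach H u v

-- The 2-core: repeatedly delete vertices of degree at most one.
-- Vertex sets are subsets S of Fin n; we work in the induced subgraph H[S].

nbhd : ∀ {n} → Graph n → Fin n → Subset n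
nbhd H v = tabulate (adj H v)

degIn : ∀ {n} → Graph n → Subset n → Fin n → ℕ
degIn H S v = ∣ S ∩ nbhd H v ∣

data PeelStep {n} (H : Graph n) : Subset n → Subset n → Set where
  peel : ∀ {S} v → v ∈ S → degIn H S v ≤ 1 → PeelStep H S (S [ v ]≔ outside)

data Peels {n} (H : Graph n) : Subset n → Subset n → Set where
  done : ∀ {S} → Peels H S S
  more : ∀ {S T U} → PeelStep H S T → Peels H T U → Peels H S U

IsTwoCore : ∀ {n} → Graph n → Subset n → Set
IsTwoCore H S = Peels H ⊤ S × (∀ v → v ∈ S → ¬ (degIn H S v ≤ 1))

IsCliqueOn : ∀ {n} → Graph n → ℕ → Subset n → Set
IsCliqueOn H k S = ∣ S ∣ ≡ k × (∀ u v → u ∈ S → v ∈ S → u ≢ v → adj H u v ≡ true)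

TwoCoreIsClique : ∀ {n} → Graph n → ℕ → Set
TwoCoreIsClique H k = ∀ S → IsTwoCore H S → IsCliqueOn H k S

Counterexample : ℕ → ∀ {n} → Graph n → Set
Counterexample k {n} H =
  Connected H × HasChromaticNumber H k ×
  ( (chromPoly H k > (k !) * (k ∸ 1) ^ (n ∸ k))
  ⊎ (chromPoly H k ≡ (k !) * (k ∸ 1) ^ (n ∸ k) × ¬ TwoCoreIsClique H k))

record ProperSubgraph {m n} (H : Graph m) (G : Graph n) : Set where
  field
    f        : Fin m → Fin n
    f-inj    : Injective _≡_ _≡_ f
    edges    : ∀ i j → adj H i j ≡ true → adj G (f i) (f j) ≡ true
    isProper : (m < n) ⊎ (Σ (Fin m) λ i → Σ (Fin m) λ j →
                 adj G (f i) (f j) ≡ true × adj H i j ≡ false)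

Bad : ℕ → ∀ {n} → Graph n → Set
Bad k {n} G =
  Counterexample k G ×
  (∀ m (H : Graph m) → Counterexample k H → n ≤ m) ×
  (∀ m (H : Graph m) → ProperSubgraph H G → ¬ Counterexample k H)

deleteVertex : ∀ {m} → Graph (suc m) → Fin (suc m) → Graph m
deleteVertex G v = record
  { adj    = λ i j → adj G (punchIn v i) (punchIn v j)
  ; sym    = λ i j → sym G (punchIn v i) (punchIn v j)
  ; irrefl = λ i → irrefl G (punchIn v i) }

isUV : ∀ {n} → Fin n → Fin n → Fin n → Fin n → Bool
isUV u v i j = (⌊ i ≟ᶠ u ⌋ ∧ ⌊ j ≟ᶠ v ⌋) ∨ (⌊ i ≟ᶠ v ⌋ ∧ ⌊ j ≟ᶠ u ⌋)

private
  isUV-sym : ∀ {n} (u v i j : Fin n) → isUV u v i j ≡ isUV u v j i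
  isUV-sym u v i j
    rewrite ∧-comm ⌊ i ≟ᶠ u ⌋ ⌊ j ≟ᶠ v ⌋ | ∧-comm ⌊ i ≟ᶠ v ⌋ ⌊ j ≟ᶠ u ⌋
    = ∨-comm (⌊ j ≟ᶠ v ⌋ ∧ ⌊ i ≟ᶠ u ⌋) (⌊ j ≟ᶠ u ⌋ ∧ ⌊ i ≟ᶠ v ⌋)

deleteEdge : ∀ {n} → Graph n → Fin n → Fin n → Graph n
deleteEdge G u v = record
  { adj    = λ i j → adj G i j ∧ not (isUV u v i j)
  ; sym    = λ i j → cong₂ _∧_ (sym G i j) (cong not (isUV-sym u v i j))
  ; irrefl = λ i → cong (_∧ not (isUV u v i i)) (irrefl G i) }

ChromaticBelow : ∀ {n} → Graph n → ℕ → Set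
ChromaticBelow H k = Σ ℕ λ j → j < k × HasChromaticNumber H j

VertexDeletionsReduce : ∀ {n} → Graph n → ℕ → Set
VertexDeletionsReduce {zero}  G k = Unit
VertexDeletionsReduce {suc m} G k = ∀ v → ChromaticBelow (deleteVertex G v) k

Critical : ℕ → ∀ {n} → Graph n → Set
Critical k G =
  HasChromaticNumber G k ×
  VertexDeletionsReduce G k ×
  (∀ u v → adj G u v ≡ true → ChromaticBelow (deleteEdge G u v) k)

module Submission where

-- A bad graph G has no vertex of degree one: deleting such a vertex z leaves a connected graph H
-- with χ(H) = k and P_G(k) ≤ (k − 1) P_H(k) whose 2-core is that of G, so H would be a smaller
-- counterexample.
--
-- If G − uv is connected but not (k − 1)-colourable, it is a proper subgraph of G with χ = k and at
-- least as many k-colourings. Not being a counterexample, it has exactly k!(k − 1)^(n − k) of them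
-- and its 2-core is a k-clique. Re-inserting the peeled vertices, each of which has at most one
-- neighbour among those already present, a k-colouring of the clique extends (as k ≥ 3) to one in
-- which the non-adjacent u and v share a colour. That colouring is not proper for G, so
-- P_G(k) < P_(G − uv)(k), a contradiction.
--
-- If instead uv is a bridge, both of its sides are (k − 1)-colourable and the colourings glue to one
-- of G − uv. For the side A avoiding v, take another neighbour w of v: either G − vw is connected and
-- the previous case colours it, or vw is a bridge whose side containing A is strictly larger.
-- Finally G − z is a subgraph of G − zw for any neighbour w of z.

open import Data.Bool using (true; false) renaming (_≟_ to _≟ᵇ_)
open import Data.Empty using (⊥-elim)
open import Data.Fin using (Fin; zero; suc; punchIn; punchOut; inject≤; fromℕ<)
open import Data.Fin.Properties
  using (any?; punchIn-punchOut; punchIn-injective; punchInᵢ≢i; inject≤-injective) renaming (_≟_ to _≟ᶠ_)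
open import Data.Fin.Subset
  using (Subset; _∈_; _∉_; _⊆_; _⊂_; _⊃_; _∩_; _∪_; ∁; ⊤; ⁅_⁆; ∣_∣; _-_; inside; outside)
open import Data.Fin.Subset.Induction using (Acc; acc; ⊂-wellFounded; ⊃-wellFounded)
open import Data.Fin.Subset.Properties
  using (_∈?_; ∈⊤; ⊆⊤; ⊆-antisym; p⊆q⇒∣p∣≤∣q∣; x∈⁅x⁆; x∈⁅y⁆⇒x≡y; ∣⁅x⁆∣≡1;
         x∈p∩q⁺; x∈p∩q⁻; p⊆p∪q; q⊆p∪q; x∈p∪q⁻; x∈p⇒x∉∁p; x∈∁p⇒x∉p; x∉∁p⇒x∈p; x∉p⇒x∈∁p;
         p─⊥≡p; x∈p∧x≢y⇒x∈p-y; x∈p⇒p-x⊂p; x∈p⇒∣p-x∣<∣p∣)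
open import Data.List using (List; []; _∷_; _++_; map; concatMap; filter; length; tabulate; allFin)
open import Data.List.Membership.Propositional using (lose) renaming (_∈_ to _∈ˡ_)
open import Data.List.Membership.Propositional.Properties using (∈-map⁺; ∈-concatMap⁺; ∈-allFin)
open import Data.List.Relation.Unary.Any as Any using (here; there)
open import Data.Nat using (ℕ; zero; suc; _+_; _*_; _∸_; _^_; _!; _≤_; _<_; _>_; _≤?_; z≤n; s≤s; NonZero)
open import Data.Nat.Properties
open import Data.Product using (Σ; _×_; _,_; proj₁; proj₂)
open import Data.Sum using (_⊎_; inj₁; inj₂; [_,_])
open import Data.Vec as Vec using (Vec; []; _∷_; lookup; insertAt; removeAt; _[_]≔_)
open import Data.Vec.Functional using (updateAt)
open import Data.Vec.Functional.Properties using (updateAt-updates; updateAt-minimal)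
open import Data.Vec.Properties
  using (insertAt-lookup; insertAt-punchIn; insertAt-removeAt; lookup∘tabulate; []=⇒lookup; lookup⇒[]=)
open import Function using (_∘_; const; flip; case_of_)
open import Relation.Binary.PropositionalEquality
  using (_≡_; _≢_; refl; sym; trans; cong; cong₂; subst; subst₂; module ≡-Reasoning)
open import Relation.Nullary using (¬_; Dec; yes; no)
open import Relation.Nullary.Decidable using (_×-dec_; ¬?; decidable-stable)

open import Algebra.Properties.CommutativeMonoid.Sum +-0-commutativeMonoid
  using (sum; sum-syntax; sum-remove; ∑-comm)

open import Defs renaming (sym to adj-sym)

adj⇒≢ : ∀ {n} (G : Graph n) {u v} → adj G u v ≡ true → u ≢ v
adj⇒≢ G {u} uv refl with () ← trans (sym uv) (irrefl G u)

proper-cong : ∀ {n k} (G : Graph n) {c c′ : Fin n → Fin k} → (∀ i → c i ≡ c′ i) → Proper G c → Proper G c′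
proper-cong G c≗c′ proper i j ij ci≡cj = proper i j ij (trans (c≗c′ i) (trans ci≡cj (sym (c≗c′ j))))

-- Counting proper colourings

𝟙 : ∀ {p} {P : Set p} → Dec P → ℕ
𝟙 (yes _) = 1
𝟙 (no _)  = 0

𝟙≤1 : ∀ {p} {P : Set p} (P? : Dec P) → 𝟙 P? ≤ 1
𝟙≤1 (yes _) = ≤-refl
𝟙≤1 (no _)  = z≤n

𝟙-no : ∀ {p} {P : Set p} (P? : Dec P) → ¬ P → 𝟙 P? ≡ 0
𝟙-no (yes p) ¬p = ⊥-elim (¬p p)
𝟙-no (no _)  ¬p = refl

𝟙-mono : ∀ {p q} {P : Set p} {Q : Set q} (P? : Dec P) (Q? : Dec Q) → (P → Q) → 𝟙 P? ≤ 𝟙 Q?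
𝟙-mono (yes p) (yes _) P⇒Q = ≤-refl
𝟙-mono (yes p) (no ¬q) P⇒Q = ⊥-elim (¬q (P⇒Q p))
𝟙-mono (no _)  Q?      P⇒Q = z≤n

𝟙-mono-< : ∀ {p q} {P : Set p} {Q : Set q} (P? : Dec P) (Q? : Dec Q) → ¬ P → Q → 𝟙 P? < 𝟙 Q?
𝟙-mono-< P? Q? ¬p q rewrite 𝟙-no P? ¬p with Q?
... | yes _ = s≤s z≤n
... | no ¬q = ⊥-elim (¬q q)

∑-zero : ∀ {n} {f : Fin n → ℕ} → (∀ i → f i ≡ 0) → sum f ≡ 0
∑-zero {zero}  f≡0 = refl
∑-zero {suc n} f≡0 = cong₂ _+_ (f≡0 zero) (∑-zero (f≡0 ∘ suc))

∑≤1⇒≤n : ∀ {n} {f : Fin n → ℕ} → (∀ i → f i ≤ 1) → sum f ≤ n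
∑≤1⇒≤n {zero}  f≤1 = z≤n
∑≤1⇒≤n {suc n} f≤1 = +-mono-≤ (f≤1 zero) (∑≤1⇒≤n (f≤1 ∘ suc))

∑≤1-vanishing⇒≤pred : ∀ {n} {f : Fin n → ℕ} (i : Fin n) → (∀ j → f j ≤ 1) → f i ≡ 0 → sum f ≤ n ∸ 1
∑≤1-vanishing⇒≤pred {suc n} {f} i f≤1 fi≡0 = begin
  sum f                        ≡⟨ sum-remove {i = i} f ⟩
  f i + sum (f ∘ punchIn i)    ≡⟨ cong (_+ sum (f ∘ punchIn i)) fi≡0 ⟩
  sum (f ∘ punchIn i)          ≤⟨ ∑≤1⇒≤n (f≤1 ∘ punchIn i) ⟩
  n                            ∎
  where open ≤-Reasoning

module _ {A : Set} where

  sumOver : List A → (A → ℕ) → ℕ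
  sumOver []       F = 0
  sumOver (x ∷ xs) F = F x + sumOver xs F

  sumOver-cong : ∀ xs {F G : A → ℕ} → (∀ x → F x ≡ G x) → sumOver xs F ≡ sumOver xs G
  sumOver-cong []       F≗G = refl
  sumOver-cong (x ∷ xs) F≗G = cong₂ _+_ (F≗G x) (sumOver-cong xs F≗G)

  sumOver-mono-≤ : ∀ xs {F G : A → ℕ} → (∀ x → F x ≤ G x) → sumOver xs F ≤ sumOver xs G
  sumOver-mono-≤ []       F≤G = z≤n
  sumOver-mono-≤ (x ∷ xs) F≤G = +-mono-≤ (F≤G x) (sumOver-mono-≤ xs F≤G)

  sumOver-mono-< : ∀ {xs} {F G : A → ℕ} → (∀ x → F x ≤ G x) → ∀ {y} → y ∈ˡ xs → F y < G y →
                   sumOver xs F < sumOver xs G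
  sumOver-mono-< {x ∷ xs} F≤G (here refl) Fy<Gy = +-mono-<-≤ Fy<Gy (sumOver-mono-≤ xs F≤G)
  sumOver-mono-< {x ∷ xs} F≤G (there y∈xs) Fy<Gy = +-mono-≤-< (F≤G x) (sumOver-mono-< F≤G y∈xs Fy<Gy)

  sumOver-++ : ∀ xs ys F → sumOver (xs ++ ys) F ≡ sumOver xs F + sumOver ys F
  sumOver-++ []       ys F = refl
  sumOver-++ (x ∷ xs) ys F = trans (cong (F x +_) (sumOver-++ xs ys F)) (sym (+-assoc (F x) _ _))

  sumOver-*ˡ : ∀ xs c F → sumOver xs (λ x → c * F x) ≡ c * sumOver xs F
  sumOver-*ˡ []       c F = sym (*-zeroʳ c)
  sumOver-*ˡ (x ∷ xs) c F =
    trans (cong (c * F x +_) (sumOver-*ˡ xs c F)) (sym (*-distribˡ-+ c (F x) _))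

  length-filter≡sumOver : ∀ {p} {P : A → Set p} (P? : ∀ x → Dec (P x)) xs →
                          length (filter P? xs) ≡ sumOver xs (𝟙 ∘ P?)
  length-filter≡sumOver P? []       = refl
  length-filter≡sumOver P? (x ∷ xs) with P? x
  ... | yes _ = cong suc (length-filter≡sumOver P? xs)
  ... | no _  = length-filter≡sumOver P? xs

sumOver-map : ∀ {A B : Set} (f : A → B) xs F → sumOver (map f xs) F ≡ sumOver xs (F ∘ f)
sumOver-map f []       F = refl
sumOver-map f (x ∷ xs) F = cong (F (f x) +_) (sumOver-map f xs F)

sumOver-concatMap : ∀ {A B : Set} (f : A → List B) xs F →
                    sumOver (concatMap f xs) F ≡ sumOver xs (λ x → sumOver (f x) F)
sumOver-concatMap f []       F = refl
sumOver-concatMap f (x ∷ xs) F =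
  trans (sumOver-++ (f x) (concatMap f xs) F) (cong (sumOver (f x) F +_) (sumOver-concatMap f xs F))

sumOver-tabulate : ∀ {B : Set} {k} (g : Fin k → B) F → sumOver (tabulate g) F ≡ sum (F ∘ g)
sumOver-tabulate {k = zero}  g F = refl
sumOver-tabulate {k = suc k} g F = cong (F (g zero) +_) (sumOver-tabulate (g ∘ suc) F)

allVecs-complete : ∀ {k n} (v : Vec (Fin k) n) → v ∈ˡ allVecs k n
allVecs-complete []      = here refl
allVecs-complete (x ∷ v) = ∈-concatMap⁺ _ (lose (allVecs-complete v) (∈-map⁺ (_∷ v) (∈-allFin x)))

∑Vec : ∀ {k} n → (Vec (Fin k) n → ℕ) → ℕ
∑Vec {k} n F = sumOver (allVecs k n) F

∑Vec-suc : ∀ {k} n (F : Vec (Fin k) (suc n) → ℕ) → ∑Vec (suc n) F ≡ ∑Vec n (λ v → ∑[ x < k ] F (x ∷ v))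
∑Vec-suc {k} n F = trans (sumOver-concatMap (λ v → map (_∷ v) (allFin k)) (allVecs k n) F)
  (sumOver-cong (allVecs k n) λ v →
    trans (sumOver-map (_∷ v) (allFin k) F) (sumOver-tabulate (λ x → x) (F ∘ (_∷ v))))

∑Vec-insertAt : ∀ {k} n (z : Fin (suc n)) (F : Vec (Fin k) (suc n) → ℕ) →
                ∑Vec (suc n) F ≡ ∑Vec n (λ v → ∑[ x < k ] F (insertAt v z x))
∑Vec-insertAt n       zero    F = ∑Vec-suc n F
∑Vec-insertAt {k} (suc n) (suc z) F = begin
  ∑Vec (suc (suc n)) F                                           ≡⟨ ∑Vec-suc (suc n) F ⟩
  ∑Vec (suc n) (λ v → ∑[ x < k ] F (x ∷ v))                      ≡⟨ ∑Vec-insertAt n z _ ⟩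
  ∑Vec n (λ u → ∑[ y < k ] ∑[ x < k ] F (x ∷ insertAt u z y))   ≡⟨ sumOver-cong (allVecs k n) swap ⟩
  ∑Vec n (λ u → ∑[ x < k ] ∑[ y < k ] F (x ∷ insertAt u z y))   ≡⟨ ∑Vec-suc n _ ⟨
  ∑Vec (suc n) (λ v → ∑[ y < k ] F (insertAt v (suc z) y))      ∎
  where
  open ≡-Reasoning
  swap = λ u → ∑-comm (λ y x → F (x ∷ insertAt u z y))

∑Vec-mono-≤ : ∀ {k} n {F G : Vec (Fin k) n → ℕ} → (∀ v → F v ≤ G v) → ∑Vec n F ≤ ∑Vec n G
∑Vec-mono-≤ {k} n = sumOver-mono-≤ (allVecs k n)

∑Vec-mono-< : ∀ {k} n {F G : Vec (Fin k) n → ℕ} → (∀ v → F v ≤ G v) → ∀ v → F v < G v → ∑Vec n F < ∑Vec n G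
∑Vec-mono-< n F≤G v = sumOver-mono-< F≤G (allVecs-complete v)

∑Vec-*ˡ : ∀ {k} n c (F : Vec (Fin k) n → ℕ) → ∑Vec n (λ v → c * F v) ≡ c * ∑Vec n F
∑Vec-*ˡ {k} n = sumOver-*ˡ (allVecs k n)

chromPoly≡∑ : ∀ {n} (G : Graph n) k → chromPoly G k ≡ ∑Vec n (λ v → 𝟙 (proper? G (lookup v)))
chromPoly≡∑ G k = length-filter≡sumOver (λ v → proper? G (lookup v)) (allVecs k _)

chromPoly-mono : ∀ {n} k {G G′ : Graph n} → (∀ {c : Fin n → Fin k} → Proper G c → Proper G′ c) →
                 chromPoly G k ≤ chromPoly G′ k
chromPoly-mono {n} k {G} {G′} G⇒G′ = begin
  chromPoly G k                                     ≡⟨ chromPoly≡∑ G k ⟩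
  ∑Vec n (λ v → 𝟙 (proper? G (lookup v)))           ≤⟨ ∑Vec-mono-≤ n (λ v → 𝟙-mono _ _ G⇒G′) ⟩
  ∑Vec n (λ v → 𝟙 (proper? G′ (lookup v)))          ≡⟨ chromPoly≡∑ G′ k ⟨
  chromPoly G′ k                                    ∎
  where open ≤-Reasoning

chromPoly-mono-< : ∀ {n} k {G G′ : Graph n} → (∀ {c : Fin n → Fin k} → Proper G c → Proper G′ c) →
                   (c : Fin n → Fin k) → Proper G′ c → ¬ Proper G c → chromPoly G k < chromPoly G′ k
chromPoly-mono-< {n} k {G} {G′} G⇒G′ c properG′ ¬properG = begin-strict
  chromPoly G k                            ≡⟨ chromPoly≡∑ G k ⟩
  ∑Vec n (λ v → 𝟙 (proper? G (lookup v)))  <⟨ ∑Vec-mono-< n (λ v → 𝟙-mono _ _ G⇒G′) (Vec.tabulate c) fewer ⟩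
  ∑Vec n (λ v → 𝟙 (proper? G′ (lookup v))) ≡⟨ chromPoly≡∑ G′ k ⟨
  chromPoly G′ k                           ∎
  where
  open ≤-Reasoning
  fewer : 𝟙 (proper? G (lookup (Vec.tabulate c))) < 𝟙 (proper? G′ (lookup (Vec.tabulate c)))
  fewer = 𝟙-mono-< _ _ (¬properG ∘ proper-cong G (lookup∘tabulate c))
                       (proper-cong G′ (sym ∘ lookup∘tabulate c) properG′)

chromPoly-deleteVertex-≤ : ∀ {m} k (G : Graph (suc m)) {z a} → adj G z a ≡ true →
                           chromPoly G k ≤ (k ∸ 1) * chromPoly (deleteVertex G z) k
chromPoly-deleteVertex-≤ {m} k G {z} {a} za = begin
  chromPoly G k                                            ≡⟨ chromPoly≡∑ G k ⟩
  ∑Vec (suc m) F                                           ≡⟨ ∑Vec-insertAt m z F ⟩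
  ∑Vec m (λ v → ∑[ x < k ] F (insertAt v z x))             ≤⟨ ∑Vec-mono-≤ m extensions≤ ⟩
  ∑Vec m (λ v → (k ∸ 1) * 𝟙 (proper? H (lookup v)))        ≡⟨ ∑Vec-*ˡ m (k ∸ 1) _ ⟩
  (k ∸ 1) * ∑Vec m (λ v → 𝟙 (proper? H (lookup v)))        ≡⟨ cong ((k ∸ 1) *_) (chromPoly≡∑ H k) ⟨
  (k ∸ 1) * chromPoly H k                                  ∎
  where
  open ≤-Reasoning
  H = deleteVertex G z
  F : Vec (Fin k) (suc m) → ℕ
  F w = 𝟙 (proper? G (lookup w))
  z≢a = adj⇒≢ G za
  a′ = punchOut z≢a
  restriction : ∀ v x → Proper G (lookup (insertAt v z x)) → Proper H (lookup v)
  restriction v x proper i j ij ci≡cj = proper (punchIn z i) (punchIn z j) ij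
    (trans (insertAt-punchIn v z x i) (trans ci≡cj (sym (insertAt-punchIn v z x j))))
  clash : ∀ v → ¬ Proper G (lookup (insertAt v z (lookup v a′)))
  clash v proper = proper z a za (trans (insertAt-lookup v z _) (sym (insertAt-a v _)))
    where
    insertAt-a : ∀ v x → lookup (insertAt v z x) a ≡ lookup v a′
    insertAt-a v x =
      trans (cong (lookup (insertAt v z x)) (sym (punchIn-punchOut z≢a))) (insertAt-punchIn v z x a′)
  extensions≤ : ∀ v → ∑[ x < k ] F (insertAt v z x) ≤ (k ∸ 1) * 𝟙 (proper? H (lookup v))
  extensions≤ v with proper? H (lookup v)
  ... | no ¬proper = ≤-reflexive (trans (∑-zero (λ x → 𝟙-no _ (¬proper ∘ restriction v x)))
                                        (sym (*-zeroʳ (k ∸ 1))))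
  ... | yes _      = ≤-trans (∑≤1-vanishing⇒≤pred (lookup v a′) (λ x → 𝟙≤1 _) (𝟙-no _ (clash v)))
                             (≤-reflexive (sym (*-identityʳ (k ∸ 1))))

-- Colourability and the chromatic number

colouring? : ∀ {n k} (P : (Fin n → Fin k) → Set) → (∀ c → Dec (P c)) →
             (∀ {c c′} → (∀ i → c i ≡ c′ i) → P c → P c′) → Dec (Σ (Fin n → Fin k) P)
colouring? {n} {k} P P? P-cong with Any.any? (P? ∘ lookup) (allVecs k n)
... | yes found = let (v , Pv) = Any.satisfied found in yes (lookup v , Pv)
... | no none   = no λ (c , Pc) →
  none (lose (allVecs-complete (Vec.tabulate c)) (P-cong (sym ∘ lookup∘tabulate c) Pc))

colourable? : ∀ {n} (G : Graph n) k → Dec (Colorable G k)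
colourable? G k = colouring? (Proper G) (proper? G) (proper-cong G)

colourable-≤ : ∀ {n j j′} (G : Graph n) → j ≤ j′ → Colorable G j → Colorable G j′
colourable-≤ G j≤j′ (c , proper) = (λ i → inject≤ (c i) j≤j′) ,
  λ i i′ ii′ → proper i i′ ii′ ∘ inject≤-injective j≤j′ j≤j′ (c i) (c i′)

hasChromaticNumber : ∀ {n j} (G : Graph n) → Colorable G (suc j) → ¬ Colorable G j →
                     HasChromaticNumber G (suc j)
hasChromaticNumber G col ¬col = col , λ i i<1+j → ¬col ∘ colourable-≤ G (≤-pred i<1+j)

chromaticNumber-≤ : ∀ {n} (G : Graph n) j → Colorable G j → Σ ℕ λ i → i ≤ j × HasChromaticNumber G i
chromaticNumber-≤ G zero    col = 0 , z≤n , col , λ _ ()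
chromaticNumber-≤ G (suc j) col with colourable? G j
... | yes col′ = let (i , i≤j , χ) = chromaticNumber-≤ G j col′ in i , m≤n⇒m≤1+n i≤j , χ
... | no ¬col  = suc j , ≤-refl , hasChromaticNumber G col ¬col

chromaticBelow : ∀ {n j} (G : Graph n) → Colorable G j → ChromaticBelow G (suc j)
chromaticBelow {j = j} G col = let (i , i≤j , χ) = chromaticNumber-≤ G j col in i , s≤s i≤j , χ

chromaticNumber≤size : ∀ {n k} (G : Graph n) → HasChromaticNumber G k → k ≤ n
chromaticNumber≤size {n} G (_ , ¬col) = ≮⇒≥ λ n<k → ¬col n n<k ((λ i → i) , λ i j → adj⇒≢ G)

data PunchInView {m} (z : Fin (suc m)) : Fin (suc m) → Set where
  at       : PunchInView z z
  punchedIn : ∀ x → PunchInView z (punchIn z x)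

punchInView : ∀ {m} (z x : Fin (suc m)) → PunchInView z x
punchInView z x with x ≟ᶠ z
... | yes refl = at
... | no x≢z   = subst (PunchInView z) (punchIn-punchOut (x≢z ∘ sym)) (punchedIn _)

colourable-deleteVertex : ∀ {m j} (G : Graph (suc m)) z → Colorable G j → Colorable (deleteVertex G z) j
colourable-deleteVertex G z (c , proper) = c ∘ punchIn z , λ i j → proper (punchIn z i) (punchIn z j)

colourable-addLeaf : ∀ {m j} (G : Graph (suc m)) {z a} → adj G z a ≡ true → (∀ y → adj G z y ≡ true → y ≡ a) →
                     Colorable (deleteVertex G z) (suc (suc j)) → Colorable G (suc (suc j))
colourable-addLeaf G {z} {a} za leaf (d , proper) = D , properD
  where
  a′ = punchOut (adj⇒≢ G za)
  colour = punchIn (d a′) zero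
  D = lookup (insertAt (Vec.tabulate d) z colour)
  D-z : D z ≡ colour
  D-z = insertAt-lookup _ z colour
  D-punchIn : ∀ i → D (punchIn z i) ≡ d i
  D-punchIn i = trans (insertAt-punchIn _ z colour i) (lookup∘tabulate d i)
  D-neighbour : ∀ {y} → adj G z y ≡ true → colour ≢ D y
  D-neighbour {y} zy = subst (λ y → colour ≢ D y) (trans (punchIn-punchOut (adj⇒≢ G za)) (sym (leaf y zy)))
    (λ e → punchInᵢ≢i (d a′) zero (trans e (D-punchIn a′)))
  properD : Proper G D
  properD i j ij with punchInView z i | punchInView z j
  ... | at           | at           = ⊥-elim (adj⇒≢ G ij refl)
  ... | at           | punchedIn _  = D-neighbour ij ∘ trans (sym D-z)
  ... | punchedIn _  | at           = D-neighbour (trans (adj-sym G z i) ij) ∘ trans (sym D-z) ∘ sym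
  ... | punchedIn i′ | punchedIn j′ = proper i′ j′ ij ∘ trans (sym (D-punchIn i′)) ∘ flip trans (D-punchIn j′)

-- Vertex sets, degrees and the 2-core

module _ {n} {p : Subset n} {x : Fin n} where

  ∈⇒lookup : x ∈ p → lookup p x ≡ true
  ∈⇒lookup = []=⇒lookup

  lookup⇒∈ : lookup p x ≡ true → x ∈ p
  lookup⇒∈ = lookup⇒[]= x p

[]≔outside≡- : ∀ {n} (p : Subset n) x → p [ x ]≔ outside ≡ p - x
[]≔outside≡- (s ∷ p) zero    = cong (outside ∷_) (sym (p─⊥≡p p))
[]≔outside≡- (s ∷ p) (suc x) = cong (s ∷_) ([]≔outside≡- p x)

x∈p∧x≢y⇒x∈p[y]≔outside : ∀ {n} {p : Subset n} {x y} → x ∈ p → x ≢ y → x ∈ p [ y ]≔ outside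
x∈p∧x≢y⇒x∈p[y]≔outside {p = p} {y = y} x∈p x≢y =
  subst (_ ∈_) (sym ([]≔outside≡- p y)) (x∈p∧x≢y⇒x∈p-y x∈p x≢y)

x∈p⇒p[x]≔outside⊂p : ∀ {n} {p : Subset n} {x} → x ∈ p → p [ x ]≔ outside ⊂ p
x∈p⇒p[x]≔outside⊂p {p = p} {x} x∈p = subst (_⊂ p) (sym ([]≔outside≡- p x)) (x∈p⇒p-x⊂p x∈p)

∣p∣≤1⇒≡ : ∀ {n} {p : Subset n} {x y} → ∣ p ∣ ≤ 1 → x ∈ p → y ∈ p → x ≡ y
∣p∣≤1⇒≡ {p = p} {x} {y} ∣p∣≤1 x∈p y∈p with y ≟ᶠ x
... | yes y≡x = sym y≡x
... | no y≢x  = ⊥-elim (<-irrefl refl (begin-strict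
  1              ≡⟨ ∣⁅x⁆∣≡1 y ⟨
  ∣ ⁅ y ⁆ ∣      ≤⟨ p⊆q⇒∣p∣≤∣q∣ ⁅y⁆⊆p-x ⟩
  ∣ p - x ∣      <⟨ x∈p⇒∣p-x∣<∣p∣ x∈p ⟩
  ∣ p ∣          ≤⟨ ∣p∣≤1 ⟩
  1              ∎))
  where
  open ≤-Reasoning
  ⁅y⁆⊆p-x : ⁅ y ⁆ ⊆ p - x
  ⁅y⁆⊆p-x z∈⁅y⁆ rewrite x∈⁅y⁆⇒x≡y y z∈⁅y⁆ = x∈p∧x≢y⇒x∈p-y y∈p y≢x

⊆⁅x⁆⇒∣p∣≤1 : ∀ {n} {p : Subset n} {x} → p ⊆ ⁅ x ⁆ → ∣ p ∣ ≤ 1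
⊆⁅x⁆⇒∣p∣≤1 {x = x} p⊆⁅x⁆ = ≤-trans (p⊆q⇒∣p∣≤∣q∣ p⊆⁅x⁆) (≤-reflexive (∣⁅x⁆∣≡1 x))

module _ {n} (H : Graph n) where

  ∈-nbhd⁺ : ∀ {v x} → adj H v x ≡ true → x ∈ nbhd H v
  ∈-nbhd⁺ {v} {x} vx = lookup⇒∈ (trans (lookup∘tabulate (adj H v) x) vx)

  ∈-nbhd⁻ : ∀ {v x} → x ∈ nbhd H v → adj H v x ≡ true
  ∈-nbhd⁻ {v} {x} x∈N = trans (sym (lookup∘tabulate (adj H v) x)) (∈⇒lookup x∈N)

  degIn-mono : ∀ {S T} v → S ⊆ T → degIn H S v ≤ degIn H T v
  degIn-mono {S} v S⊆T = p⊆q⇒∣p∣≤∣q∣ λ x∈S∩N →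
    let (x∈S , x∈N) = x∈p∩q⁻ S _ x∈S∩N in x∈p∩q⁺ (S⊆T x∈S , x∈N)

  degIn≤1⇒neighbour-unique : ∀ {S w x y} → degIn H S w ≤ 1 →
                              x ∈ S → adj H w x ≡ true → y ∈ S → adj H w y ≡ true → x ≡ y
  degIn≤1⇒neighbour-unique deg≤1 x∈S wx y∈S wy =
    ∣p∣≤1⇒≡ deg≤1 (x∈p∩q⁺ (x∈S , ∈-nbhd⁺ wx)) (x∈p∩q⁺ (y∈S , ∈-nbhd⁺ wy))

  leaf-degIn≤1 : ∀ {z a} → (∀ y → adj H z y ≡ true → y ≡ a) → ∀ S → degIn H S z ≤ 1
  leaf-degIn≤1 {z} {a} leaf S = ⊆⁅x⁆⇒∣p∣≤1 {x = a} λ {y} y∈S∩N →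
    subst (_∈ ⁅ a ⁆) (sym (leaf y (∈-nbhd⁻ (proj₂ (x∈p∩q⁻ S _ y∈S∩N))))) (x∈⁅x⁆ a)

  Unpeelable : Subset n → Set
  Unpeelable S = ∀ v → v ∈ S → ¬ (degIn H S v ≤ 1)

  peels-snoc : ∀ {A B C} → Peels H A B → PeelStep H B C → Peels H A C
  peels-snoc done        s′ = more s′ done
  peels-snoc (more s ps) s′ = more s (peels-snoc ps s′)

  twoCore-exists : Σ (Subset n) (IsTwoCore H)
  twoCore-exists = peelFrom ⊤ (⊂-wellFounded ⊤) done
    where
    peelFrom : ∀ S → Acc _⊂_ S → Peels H ⊤ S → Σ (Subset n) (IsTwoCore H)
    peelFrom S (acc smaller) peels with any? (λ v → (v ∈? S) ×-dec (degIn H S v ≤? 1))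
    ... | yes (v , v∈S , deg≤1) = peelFrom (S [ v ]≔ outside) (smaller (x∈p⇒p[x]≔outside⊂p v∈S))
                                           (peels-snoc peels (peel v v∈S deg≤1))
    ... | no  none              = S , peels , λ v v∈S deg≤1 → none (v , v∈S , deg≤1)

  peels-⊇ : ∀ {A S D} → Peels H A S → Unpeelable D → D ⊆ A → D ⊆ S
  peels-⊇ done                            unpeelable D⊆A = D⊆A
  peels-⊇ (more (peel v v∈A deg≤1) peels) unpeelable D⊆A = peels-⊇ peels unpeelable D⊆A-v
    where
    D⊆A-v : _ ⊆ _
    D⊆A-v {x} x∈D = x∈p∧x≢y⇒x∈p[y]≔outside (D⊆A x∈D) λ { refl →
      unpeelable x x∈D (≤-trans (degIn-mono x D⊆A) deg≤1) }

-- The 2-core after deleting a leaf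

lift : ∀ {m} → Fin (suc m) → Subset m → Subset (suc m)
lift z C = insertAt C z outside

module _ {m} (z : Fin (suc m)) {C : Subset m} where

  z∉lift : z ∉ lift z C
  z∉lift z∈ with () ← trans (sym (insertAt-lookup C z outside)) (∈⇒lookup z∈)

  ∈-lift⁺ : ∀ {x} → x ∈ C → punchIn z x ∈ lift z C
  ∈-lift⁺ {x} x∈C = lookup⇒∈ (trans (insertAt-punchIn C z outside x) (∈⇒lookup x∈C))

  ∈-lift⁻ : ∀ {x} → punchIn z x ∈ lift z C → x ∈ C
  ∈-lift⁻ {x} x∈ = lookup⇒∈ (trans (sym (insertAt-punchIn C z outside x)) (∈⇒lookup x∈))

lift-mono : ∀ {m} (z : Fin (suc m)) {C D} → C ⊆ D → lift z C ⊆ lift z D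
lift-mono z C⊆D {x} x∈ with punchInView z x
... | at          = ⊥-elim (z∉lift z x∈)
... | punchedIn _ = ∈-lift⁺ z (C⊆D (∈-lift⁻ z x∈))

∣lift∣ : ∀ {m} (z : Fin (suc m)) (C : Subset m) → ∣ lift z C ∣ ≡ ∣ C ∣
∣lift∣ zero    C               = refl
∣lift∣ (suc z) (inside  ∷ C) = cong suc (∣lift∣ z C)
∣lift∣ (suc z) (outside ∷ C) = ∣lift∣ z C

lift-removeAt : ∀ {m} {z : Fin (suc m)} {S} → z ∉ S → lift z (removeAt S z) ≡ S
lift-removeAt {z = z} {S} z∉S with lookup S z in eq
... | false = subst (λ b → insertAt (removeAt S z) z b ≡ S) eq (insertAt-removeAt S z)
... | true  = ⊥-elim (z∉S (lookup⇒∈ eq))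

module _ {m} (G : Graph (suc m)) (z : Fin (suc m)) where

  private
    H = deleteVertex G z

  degIn-lift : ∀ C x → degIn G (lift z C) (punchIn z x) ≡ degIn H C x
  degIn-lift C x = trans (cong ∣_∣ (⊆-antisym ⊆lift ⊇lift)) (∣lift∣ z (C ∩ nbhd H x))
    where
    ⊆lift : lift z C ∩ nbhd G (punchIn z x) ⊆ lift z (C ∩ nbhd H x)
    ⊆lift {y} y∈ with x∈p∩q⁻ (lift z C) _ y∈ | punchInView z y
    ... | y∈C , _   | at           = ⊥-elim (z∉lift z y∈C)
    ... | y∈C , y∈N | punchedIn y′ = ∈-lift⁺ z (x∈p∩q⁺ (∈-lift⁻ z y∈C , ∈-nbhd⁺ H (∈-nbhd⁻ G y∈N)))
    ⊇lift : lift z (C ∩ nbhd H x) ⊆ lift z C ∩ nbhd G (punchIn z x)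
    ⊇lift {y} y∈ with punchInView z y
    ... | at           = ⊥-elim (z∉lift z y∈)
    ... | punchedIn y′ = let (y′∈C , y′∈N) = x∈p∩q⁻ C _ (∈-lift⁻ z y∈) in
                         x∈p∩q⁺ (∈-lift⁺ z y′∈C , ∈-nbhd⁺ G (∈-nbhd⁻ H y′∈N))

  unpeelable-lift : ∀ {C} → Unpeelable H C → Unpeelable G (lift z C)
  unpeelable-lift {C} unpeelable y y∈ with punchInView z y
  ... | at           = ⊥-elim (z∉lift z y∈)
  ... | punchedIn y′ = subst (λ d → ¬ d ≤ 1) (sym (degIn-lift C y′)) (unpeelable y′ (∈-lift⁻ z y∈))

  unpeelable-unlift : ∀ {C} → Unpeelable G (lift z C) → Unpeelable H C
  unpeelable-unlift {C} unpeelable x x∈C =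
    subst (λ d → ¬ d ≤ 1) (degIn-lift C x) (unpeelable (punchIn z x) (∈-lift⁺ z x∈C))

  isClique-lift : ∀ {k C} → IsCliqueOn H k C → IsCliqueOn G k (lift z C)
  isClique-lift {C = C} (size , adjacent) = trans (∣lift∣ z C) size , adjacent′
    where
    adjacent′ : ∀ u v → u ∈ lift z C → v ∈ lift z C → u ≢ v → adj G u v ≡ true
    adjacent′ u v u∈ v∈ u≢v with punchInView z u | punchInView z v
    ... | at           | _            = ⊥-elim (z∉lift z u∈)
    ... | punchedIn _  | at           = ⊥-elim (z∉lift z v∈)
    ... | punchedIn u′ | punchedIn v′ = adjacent u′ v′ (∈-lift⁻ z u∈) (∈-lift⁻ z v∈) (u≢v ∘ cong (punchIn z))

  module _ {a} (leaf : ∀ y → adj G z y ≡ true → y ≡ a) where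

    twoCore-deleteLeaf : ∀ {S C} → IsTwoCore G S → IsTwoCore H C → S ≡ lift z C
    twoCore-deleteLeaf {S} {C} (peelsS , unpeelableS) (peelsC , unpeelableC) = ⊆-antisym S⊆liftC liftC⊆S
      where
      z∉S : z ∉ S
      z∉S z∈S = unpeelableS z z∈S (leaf-degIn≤1 G leaf S)
      liftC⊆S : lift z C ⊆ S
      liftC⊆S = peels-⊇ G peelsS (unpeelable-lift unpeelableC) ⊆⊤
      S≡lift : lift z (removeAt S z) ≡ S
      S≡lift = lift-removeAt z∉S
      removeAt⊆C : removeAt S z ⊆ C
      removeAt⊆C = peels-⊇ H peelsC (unpeelable-unlift (subst (Unpeelable G) (sym S≡lift) unpeelableS)) ⊆⊤
      S⊆liftC : S ⊆ lift z C
      S⊆liftC = subst (_⊆ lift z C) S≡lift (lift-mono z removeAt⊆C)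

    twoCoreIsClique-addLeaf : ∀ {k} → TwoCoreIsClique H k → TwoCoreIsClique G k
    twoCoreIsClique-addLeaf {k} clique S coreS =
      let (C , coreC) = twoCore-exists H in
      subst (IsCliqueOn G k) (sym (twoCore-deleteLeaf coreS coreC)) (isClique-lift (clique C coreC))

-- Colourings of a peeled graph

ProperOn : ∀ {n} (G : Graph n) → Subset n → ∀ {k} → (Fin n → Fin k) → Set
ProperOn G A c = ∀ i j → i ∈ A → j ∈ A → adj G i j ≡ true → c i ≢ c j

proper⇒properOn : ∀ {n k} (G : Graph n) {A} {c : Fin n → Fin k} → Proper G c → ProperOn G A c
proper⇒properOn G proper i j _ _ = proper i j

properOn-⊆ : ∀ {n k} (G : Graph n) {A B} {c : Fin n → Fin k} → A ⊆ B → ProperOn G B c → ProperOn G A c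
properOn-⊆ G A⊆B proper i j i∈A j∈A = proper i j (A⊆B i∈A) (A⊆B j∈A)

ColourableOn : ∀ {n} → Graph n → Subset n → ℕ → Set
ColourableOn {n} G A k = Σ (Fin n → Fin k) (ProperOn G A)

avoiding : ∀ {k} (a b : Fin (3 + k)) → Σ (Fin (3 + k)) λ c → c ≢ a × c ≢ b
avoiding a b with punchInView a b
... | at           = punchIn a zero , punchInᵢ≢i a zero , punchInᵢ≢i a zero
... | punchedIn b′ = punchIn a (punchIn b′ zero) , punchInᵢ≢i a _ ,
                     punchInᵢ≢i b′ zero ∘ punchIn-injective a _ _

-- Separating and Merging hold on a k-clique and survive re-inserting a peeled vertex w: w has at
-- most one neighbour present, so with three colours it can avoid that neighbour's colour and one more.
module PeelingColourings {n k} (G : Graph n) (c₀ : Fin n → Fin (3 + k)) (proper₀ : Proper G c₀) where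

  Colouring : Set
  Colouring = Fin n → Fin (3 + k)

  Separating : Subset n → Set
  Separating A = ∀ {u v} → u ∈ A → v ∈ A → u ≢ v → Σ Colouring λ c → ProperOn G A c × c u ≢ c v

  Merging : Subset n → Set
  Merging A = ∀ {u v} → u ∈ A → v ∈ A → u ≢ v → adj G u v ≡ false → Σ Colouring λ c → ProperOn G A c × c u ≡ c v

  module Unpeel {A w} (deg≤1 : degIn G A w ≤ 1) where

    A⁻ : Subset n
    A⁻ = A [ w ]≔ outside

    ∈A⁻ : ∀ {x} → x ∈ A → x ≢ w → x ∈ A⁻
    ∈A⁻ = x∈p∧x≢y⇒x∈p[y]≔outside

    recolour : Colouring → Fin (3 + k) → Colouring
    recolour c col = updateAt c w (const col)

    recolour-w : ∀ c col → recolour c col w ≡ col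
    recolour-w c col = updateAt-updates w c

    recolour-other : ∀ c col {x} → x ≢ w → recolour c col x ≡ c x
    recolour-other c col {x} x≢w = updateAt-minimal x w c x≢w

    Fresh : Colouring → Fin (3 + k) → Set
    Fresh c col = ∀ {y} → y ∈ A → adj G w y ≡ true → col ≢ c y

    extend : ∀ {c col} → ProperOn G A⁻ c → Fresh c col → ProperOn G A (recolour c col)
    extend {c} {col} proper fresh i j i∈A j∈A ij with i ≟ᶠ w | j ≟ᶠ w
    ... | yes refl | yes refl = ⊥-elim (adj⇒≢ G ij refl)
    ... | yes refl | no j≢w  = λ e → fresh j∈A ij
          (trans (sym (recolour-w c col)) (trans e (recolour-other c col j≢w)))
    ... | no i≢w  | yes refl = λ e → fresh i∈A (trans (adj-sym G w i) ij)
          (trans (sym (recolour-w c col)) (trans (sym e) (recolour-other c col i≢w)))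
    ... | no i≢w  | no j≢w  = λ e → proper i j (∈A⁻ i∈A i≢w) (∈A⁻ j∈A j≢w) ij
          (trans (sym (recolour-other c col i≢w)) (trans e (recolour-other c col j≢w)))

    Neighbour : Set
    Neighbour = Σ (Fin n) λ x → x ∈ A × adj G w x ≡ true

    neighbour? : Dec Neighbour
    neighbour? = any? λ x → (x ∈? A) ×-dec (adj G w x ≟ᵇ true)

    fresh-unless-neighbour : ∀ {c col} ((x , _) : Neighbour) → col ≢ c x → Fresh c col
    fresh-unless-neighbour {c} (x , x∈A , wx) col≢cx y∈A wy =
      col≢cx ∘ subst (λ y → _ ≡ c y) (degIn≤1⇒neighbour-unique G deg≤1 y∈A wy x∈A wx)

    fresh-if-isolated : ∀ {c col} → ¬ Neighbour → Fresh c col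
    fresh-if-isolated none y∈A wy = ⊥-elim (none (_ , y∈A , wy))

    extendAvoiding : ∀ {c} → ProperOn G A⁻ c → ∀ b →
                     Σ (Fin (3 + k)) λ col → col ≢ b × ProperOn G A (recolour c col)
    extendAvoiding {c} proper b with neighbour?
    ... | yes nb@(x , _) = let (col , col≢cx , col≢b) = avoiding (c x) b in
                           col , col≢b , extend proper (fresh-unless-neighbour nb col≢cx)
    ... | no none        = let (col , col≢b , _) = avoiding b b in
                           col , col≢b , extend proper (fresh-if-isolated {c} none)

    separate-w : ∀ {v} → v ∈ A → v ≢ w → Σ Colouring λ c → ProperOn G A c × c w ≢ c v
    separate-w {v} v∈A v≢w =
      let (col , col≢c₀v , proper) = extendAvoiding (proper⇒properOn G proper₀) (c₀ v) in
      recolour c₀ col , proper ,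
      λ e → col≢c₀v (trans (sym (recolour-w c₀ col)) (trans e (recolour-other c₀ col v≢w)))

    recolourLike : ∀ {c v} → ProperOn G A⁻ c → Fresh c (c v) → v ≢ w →
                   Σ Colouring λ c′ → ProperOn G A c′ × c′ w ≡ c′ v
    recolourLike {c} {v} proper fresh v≢w =
      recolour c (c v) , extend proper fresh , trans (recolour-w c (c v)) (sym (recolour-other c (c v) v≢w))

    merge-w : Separating A⁻ → ∀ {v} → v ∈ A → v ≢ w → adj G w v ≡ false →
              Σ Colouring λ c → ProperOn G A c × c w ≡ c v
    merge-w separate {v} v∈A v≢w wv with neighbour?
    ... | no none = recolourLike (proper⇒properOn G proper₀) (fresh-if-isolated {c₀} none) v≢w
    ... | yes nb@(x , x∈A , wx) =
      let (c , proper , cv≢cx) = separate (∈A⁻ v∈A v≢w) (∈A⁻ x∈A (adj⇒≢ G wx ∘ sym)) (x≢v ∘ sym) in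
      recolourLike proper (fresh-unless-neighbour nb cv≢cx) v≢w
      where
      x≢v : x ≢ v
      x≢v refl with () ← trans (sym wx) wv

    separating : Separating A⁻ → Separating A
    separating separate {u} {v} u∈A v∈A u≢v with u ≟ᶠ w | v ≟ᶠ w
    ... | yes refl | _        = separate-w v∈A (u≢v ∘ sym)
    ... | no u≢w   | yes refl = let (c , proper , cw≢cu) = separate-w u∈A u≢w in c , proper , cw≢cu ∘ sym
    ... | no u≢w   | no v≢w   =
      let (c , proper , cu≢cv) = separate (∈A⁻ u∈A u≢w) (∈A⁻ v∈A v≢w) u≢v
          (col , _ , proper′) = extendAvoiding proper zero
      in recolour c col , proper′ ,
         λ e → cu≢cv (trans (sym (recolour-other c col u≢w)) (trans e (recolour-other c col v≢w)))

    merging : Separating A⁻ → Merging A⁻ → Merging A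
    merging separate merge {u} {v} u∈A v∈A u≢v uv with u ≟ᶠ w | v ≟ᶠ w
    ... | yes refl | _        = merge-w separate v∈A (u≢v ∘ sym) uv
    ... | no u≢w   | yes refl =
      let (c , proper , cw≡cu) = merge-w separate u∈A u≢w (trans (adj-sym G w u) uv) in c , proper , sym cw≡cu
    ... | no u≢w   | no v≢w   =
      let (c , proper , cu≡cv) = merge (∈A⁻ u∈A u≢w) (∈A⁻ v∈A v≢w) u≢v uv
          (col , _ , proper′) = extendAvoiding proper zero
      in recolour c col , proper′ ,
         trans (recolour-other c col u≢w) (trans cu≡cv (sym (recolour-other c col v≢w)))

  unpeel : ∀ {A C} → Peels G A C → Separating C × Merging C → Separating A × Merging A
  unpeel done                                flexible = flexible
  unpeel {A} (more (peel w w∈A deg≤1) peels) flexible with unpeel peels flexible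
  ... | separate , merge = separating separate , merging separate merge
    where open Unpeel {A} {w} deg≤1

  clique-flexible : ∀ {C} → IsCliqueOn G (3 + k) C → Separating C × Merging C
  clique-flexible (_ , adjacent) =
    (λ {u} {v} u∈C v∈C u≢v → c₀ , proper⇒properOn G proper₀ , proper₀ u v (adjacent u v u∈C v∈C u≢v)) ,
    (λ {u} {v} u∈C v∈C u≢v uv → case trans (sym (adjacent u v u∈C v∈C u≢v)) uv of λ ())

  sameColour : TwoCoreIsClique G (3 + k) → ∀ {u v} → u ≢ v → adj G u v ≡ false →
               Σ Colouring λ c → Proper G c × c u ≡ c v
  sameColour clique u≢v uv =
    let (C , core@(peels , _)) = twoCore-exists G
        (_ , merge) = unpeel peels (clique-flexible (clique C core))
        (c , proper , cu≡cv) = merge ∈⊤ ∈⊤ u≢v uv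
    in c , (λ i j → proper i j ∈⊤ ∈⊤) , cu≡cv

-- Paths, components and edge deletion

module _ {n} {H : Graph n} where

  reach-snoc : ∀ {u v w} → Reach H u v → adj H v w ≡ true → Reach H u w
  reach-snoc here         vw = step vw here
  reach-snoc (step uv vw) wx = step uv (reach-snoc vw wx)

  reach-trans : ∀ {u v w} → Reach H u v → Reach H v w → Reach H u w
  reach-trans here         vw = vw
  reach-trans (step ux xv) vw = step ux (reach-trans xv vw)

  reach-sym : ∀ {u v} → Reach H u v → Reach H v u
  reach-sym here         = here
  reach-sym (step ux xv) = reach-snoc (reach-sym xv) (trans (adj-sym H _ _) ux)

reach⇒neighbour : ∀ {n} {G : Graph n} {u v} → Reach G u v → u ≢ v → Σ (Fin n) λ w → adj G u w ≡ true
reach⇒neighbour here         u≢u = ⊥-elim (u≢u refl)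
reach⇒neighbour (step uw _) _   = _ , uw

record Component {n} (H : Graph n) (u : Fin n) : Set where
  field
    members   : Subset n
    root      : u ∈ members
    closed    : ∀ {x y} → x ∈ members → adj H x y ≡ true → y ∈ members
    reachable : ∀ {x} → x ∈ members → Reach H u x

component : ∀ {n} (H : Graph n) (u : Fin n) → Component H u
component {n} H u =
  grow ⁅ u ⁆ (⊃-wellFounded ⁅ u ⁆) (x∈⁅x⁆ u) λ x∈⁅u⁆ → subst (Reach H u) (sym (x∈⁅y⁆⇒x≡y u x∈⁅u⁆)) here
  where
  grow : ∀ R → Acc _⊃_ R → u ∈ R → (∀ {x} → x ∈ R → Reach H u x) → Component H u
  grow R (acc larger) u∈R reachable
    with any? (λ x → any? λ y → (x ∈? R) ×-dec (¬? (y ∈? R) ×-dec (adj H x y ≟ᵇ true)))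
  ... | yes (x , y , x∈R , y∉R , xy) = grow (R ∪ ⁅ y ⁆) (larger R⊂R∪y) (p⊆p∪q _ u∈R) reachable′
    where
    R⊂R∪y : R ⊂ R ∪ ⁅ y ⁆
    R⊂R∪y = p⊆p∪q _ , y , q⊆p∪q R _ (x∈⁅x⁆ y) , y∉R
    reachable′ : ∀ {z} → z ∈ R ∪ ⁅ y ⁆ → Reach H u z
    reachable′ z∈ with x∈p∪q⁻ R _ z∈
    ... | inj₁ z∈R   = reachable z∈R
    ... | inj₂ z∈⁅y⁆ rewrite x∈⁅y⁆⇒x≡y y z∈⁅y⁆ = reach-snoc (reachable x∈R) xy
  ... | no none = record { members = R ; root = u∈R ; closed = closed ; reachable = reachable }
    where
    closed : ∀ {x y} → x ∈ R → adj H x y ≡ true → y ∈ R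
    closed {x} {y} x∈R xy with y ∈? R
    ... | yes y∈R = y∈R
    ... | no  y∉R = ⊥-elim (none (x , y , x∈R , y∉R , xy))

isUV⇒ : ∀ {n} {u v i j : Fin n} → isUV u v i j ≡ true → (i ≡ u × j ≡ v) ⊎ (i ≡ v × j ≡ u)
isUV⇒ {u = u} {v} {i} {j} uv with i ≟ᶠ u | j ≟ᶠ v | i ≟ᶠ v | j ≟ᶠ u
... | yes i≡u | yes j≡v | _       | _       = inj₁ (i≡u , j≡v)
... | _       | _       | yes i≡v | yes j≡u = inj₂ (i≡v , j≡u)
... | no _    | _       | no _    | _       with () ← uv
... | no _    | _       | yes _   | no _    with () ← uv
... | yes _   | no _    | no _    | _       with () ← uv
... | yes _   | no _    | yes _   | no _    with () ← uv

isUV-self : ∀ {n} (u v : Fin n) → isUV u v u v ≡ true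
isUV-self u v with u ≟ᶠ u | v ≟ᶠ v
... | yes _ | yes _ = refl
... | no u≢u | _    = ⊥-elim (u≢u refl)
... | yes _ | no v≢v = ⊥-elim (v≢v refl)

module _ {n} (G : Graph n) {p q : Fin n} where

  deleteEdge-⊆ : ∀ {i j} → adj (deleteEdge G p q) i j ≡ true → adj G i j ≡ true
  deleteEdge-⊆ {i} {j} ij with adj G i j
  ... | true = refl

  deleteEdge-removes : adj (deleteEdge G p q) p q ≡ false
  deleteEdge-removes rewrite isUV-self p q with adj G p q
  ... | true  = refl
  ... | false = refl

  deleteEdge-removed : ∀ {i j} → adj G i j ≡ true → adj (deleteEdge G p q) i j ≡ false →
                       (i ≡ p × j ≡ q) ⊎ (i ≡ q × j ≡ p)
  deleteEdge-removed {i} {j} ij ¬ij rewrite ij with isUV p q i j in pq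
  ... | true = isUV⇒ pq

  deleteEdge-kept : ∀ {i j} → adj G i j ≡ true → i ≢ p → j ≢ p → adj (deleteEdge G p q) i j ≡ true
  deleteEdge-kept {i} {j} ij i≢p j≢p with adj (deleteEdge G p q) i j in ij′
  ... | true  = refl
  ... | false with deleteEdge-removed ij ij′
  ...   | inj₁ (i≡p , _) = ⊥-elim (i≢p i≡p)
  ...   | inj₂ (_ , j≡p) = ⊥-elim (j≢p j≡p)

  proper-deleteEdge : ∀ {k} {c : Fin n → Fin k} → Proper G c → Proper (deleteEdge G p q) c
  proper-deleteEdge proper i j = proper i j ∘ deleteEdge-⊆

  crossing-deleteEdge : ∀ {R x y} → (∀ {x y} → x ∈ R → adj (deleteEdge G p q) x y ≡ true → y ∈ R) →
                        x ∈ R → y ∉ R → adj G x y ≡ true → (x ≡ p × y ≡ q) ⊎ (x ≡ q × y ≡ p)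
  crossing-deleteEdge {x = x} {y} closed x∈R y∉R xy with adj (deleteEdge G p q) x y in xy′
  ... | true  = ⊥-elim (y∉R (closed x∈R xy′))
  ... | false = deleteEdge-removed xy xy′

  deleteEdge-connected : Connected G → Reach (deleteEdge G p q) p q → Connected (deleteEdge G p q)
  deleteEdge-connected connected p↝q x y = avoid (connected x y)
    where
    avoid : ∀ {x y} → Reach G x y → Reach (deleteEdge G p q) x y
    avoid here = here
    avoid (step {u = x} {v = x′} xx′ x′↝y) with adj (deleteEdge G p q) x x′ in xx′′
    ... | true  = step xx′′ (avoid x′↝y)
    ... | false with deleteEdge-removed xx′ xx′′
    ...   | inj₁ (refl , refl) = reach-trans p↝q (avoid x′↝y)
    ...   | inj₂ (refl , refl) = reach-trans (reach-sym p↝q) (avoid x′↝y)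

deleteLeaf-connected : ∀ {m} (G : Graph (suc m)) {z a} → (∀ y → adj G z y ≡ true → y ≡ a) →
                       Connected G → Connected (deleteVertex G z)
deleteLeaf-connected G {z} leaf connected x y = avoid (connected (punchIn z x) (punchIn z y)) refl refl
  where
  avoid : ∀ {u v} → Reach G u v → ∀ {x y} → u ≡ punchIn z x → v ≡ punchIn z y → Reach (deleteVertex G z) x y
  avoid here u≡ v≡ = subst (Reach _ _) (punchIn-injective z _ _ (trans (sym u≡) v≡)) here
  avoid (step {v = w} uw w↝v) u≡ v≡ with w ≟ᶠ z
  ... | no w≢z = step (subst₂ (λ s t → adj G s t ≡ true) u≡ w≡ uw) (avoid w↝v w≡ v≡)
    where
    w≡ = sym (punchIn-punchOut (w≢z ∘ sym))
  ... | yes refl with w↝v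
  ...   | here          = ⊥-elim (punchInᵢ≢i z _ (sym v≡))
  ...   | step zw′ w′↝v = avoid w′↝v (trans (leaf _ zw′) (trans (sym (leaf _ (trans (adj-sym G z _) uw))) u≡))
                                       v≡

-- Cuts

properOn-deleteEdge : ∀ {n k} (G : Graph n) {A p q} {c : Fin n → Fin k} →
                      ProperOn G A c → ProperOn (deleteEdge G p q) A c
properOn-deleteEdge G proper i j i∈A j∈A = proper i j i∈A j∈A ∘ deleteEdge-⊆ G

colourable-glue : ∀ {n k} (G : Graph n) {R} → (∀ {x y} → x ∈ R → adj G x y ≡ true → y ∈ R) →
                  ColourableOn G R k → ColourableOn G (∁ R) k → Colorable G k
colourable-glue {n} {k} G {R} closed (c₁ , proper₁) (c₂ , proper₂) = c , proper
  where
  pick : ∀ {x} → Dec (x ∈ R) → Fin k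
  pick {x} (yes _) = c₁ x
  pick {x} (no _)  = c₂ x
  c : Fin n → Fin k
  c x = pick (x ∈? R)
  proper : Proper G c
  proper i j ij with i ∈? R | j ∈? R
  ... | yes i∈R | yes j∈R = proper₁ i j i∈R j∈R ij
  ... | no  i∉R | no  j∉R = proper₂ i j (x∉p⇒x∈∁p i∉R) (x∉p⇒x∈∁p j∉R) ij
  ... | yes i∈R | no  j∉R = ⊥-elim (j∉R (closed i∈R ij))
  ... | no  i∉R | yes j∈R = ⊥-elim (i∉R (closed j∈R (trans (adj-sym G j i) ij)))

record Cut {n} (G : Graph n) (A : Subset n) (u v : Fin n) : Set where
  field
    u∈A  : u ∈ A
    v∉A  : v ∉ A
    uv   : adj G u v ≡ true
    only : ∀ {x y} → x ∈ A → y ∉ A → adj G x y ≡ true → x ≡ u × y ≡ v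

module _ {n} (G : Graph n) where

  cut-∁ : ∀ {A u v} → Cut G A u v → Cut G (∁ A) v u
  cut-∁ {A} {u} {v} cut = record
    { u∈A  = x∉p⇒x∈∁p v∉A
    ; v∉A  = x∈p⇒x∉∁p u∈A
    ; uv   = trans (adj-sym G v u) uv
    ; only = λ x∈∁A y∉∁A xy → let (y≡u , x≡v) = only (x∉∁p⇒x∈p y∉∁A) (x∈∁p⇒x∉p x∈∁A) (trans (adj-sym G _ _) xy)
                               in x≡v , y≡u }
    where open Cut cut

  cut-∪ : ∀ {A R u v w} → Cut G A u v → Cut G R v w → w ≢ u → Cut G (A ∪ R) v w
  cut-∪ {A} {R} {u} {v} {w} cutA cutR w≢u = record
    { u∈A  = q⊆p∪q A R (Cut.u∈A cutR)
    ; v∉A  = [ w∉A , Cut.v∉A cutR ] ∘ x∈p∪q⁻ A R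
    ; uv   = Cut.uv cutR
    ; only = only }
    where
    w∉A : w ∉ A
    w∉A w∈A = w≢u (proj₁ (Cut.only cutA w∈A (Cut.v∉A cutA) (trans (adj-sym G w v) (Cut.uv cutR))))
    only : ∀ {x y} → x ∈ A ∪ R → y ∉ A ∪ R → adj G x y ≡ true → x ≡ v × y ≡ w
    only x∈ y∉ xy with x∈p∪q⁻ A R x∈
    ... | inj₁ x∈A with refl ← proj₂ (Cut.only cutA x∈A (y∉ ∘ p⊆p∪q R) xy) =
      ⊥-elim (y∉ (q⊆p∪q A R (Cut.u∈A cutR)))
    ... | inj₂ x∈R = Cut.only cutR x∈R (y∉ ∘ q⊆p∪q A R) xy

  component-cut : ∀ {u v} → adj G u v ≡ true → (R : Component (deleteEdge G u v) u) →
                  v ∉ Component.members R → Cut G (Component.members R) u v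
  component-cut uv R v∉R = record { u∈A = root ; v∉A = v∉R ; uv = uv ; only = only }
    where
    open Component R
    only : ∀ {x y} → x ∈ members → y ∉ members → adj G x y ≡ true → _
    only x∈R y∉R xy with crossing-deleteEdge G closed x∈R y∉R xy
    ... | inj₁ x≡u×y≡v      = x≡u×y≡v
    ... | inj₂ (refl , refl) = ⊥-elim (v∉R x∈R)

-- Bad graphs

bound : ℕ → ℕ → ℕ
bound k n = k ! * (k ∸ 1) ^ (n ∸ k)

Exceeds : ℕ → ∀ {n} → Graph n → Set
Exceeds k {n} H = (chromPoly H k > bound k n) ⊎ (chromPoly H k ≡ bound k n × ¬ TwoCoreIsClique H k)

bound-suc : ∀ {k m} → k ≤ m → (k ∸ 1) * bound k m ≡ bound k (suc m)
bound-suc {k} {m} k≤m = begin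
  (k ∸ 1) * (k ! * (k ∸ 1) ^ (m ∸ k))    ≡⟨ *-assoc (k ∸ 1) (k !) _ ⟨
  (k ∸ 1) * k ! * (k ∸ 1) ^ (m ∸ k)      ≡⟨ cong (_* (k ∸ 1) ^ (m ∸ k)) (*-comm (k ∸ 1) (k !)) ⟩
  k ! * (k ∸ 1) * (k ∸ 1) ^ (m ∸ k)      ≡⟨ *-assoc (k !) (k ∸ 1) _ ⟩
  k ! * (k ∸ 1) ^ suc (m ∸ k)            ≡⟨ cong (λ e → k ! * (k ∸ 1) ^ e) (+-∸-assoc 1 k≤m) ⟨
  k ! * (k ∸ 1) ^ (suc m ∸ k)            ∎
  where open ≡-Reasoning

exceeds-transfer : ∀ {k m n} {G : Graph m} {H : Graph n} c .{{_ : NonZero c}} →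
                   chromPoly G k ≤ c * chromPoly H k → c * bound k n ≡ bound k m →
                   (chromPoly H k ≡ bound k n → TwoCoreIsClique H k →
                    chromPoly G k < bound k m ⊎ TwoCoreIsClique G k) →
                   Exceeds k G → Exceeds k H
exceeds-transfer {k} {m} {n} {G} {H} c PG≤cPH cB≡B tight (inj₁ B<PG) = inj₁ (*-cancelˡ-< c _ _ (begin-strict
  c * bound k n    ≡⟨ cB≡B ⟩
  bound k m        <⟨ B<PG ⟩
  chromPoly G k    ≤⟨ PG≤cPH ⟩
  c * chromPoly H k ∎))
  where open ≤-Reasoning
exceeds-transfer {k} {m} {n} {G} {H} c PG≤cPH cB≡B tight (inj₂ (PG≡B , ¬clique))
  with m≤n⇒m<n∨m≡n (*-cancelˡ-≤ c (subst (_≤ c * chromPoly H k) (trans PG≡B (sym cB≡B)) PG≤cPH))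
... | inj₁ B<PH = inj₁ B<PH
... | inj₂ B≡PH = inj₂ (sym B≡PH , [ <-irrefl PG≡B , ¬clique ] ∘ tight (sym B≡PH))

module BadGraph {k′ m} (G : Graph (suc m)) (bad : Bad (3 + k′) G) where

  k₁ k : ℕ
  k₁ = 2 + k′
  k  = suc k₁

  connected : Connected G
  connected = proj₁ (proj₁ bad)

  χG : HasChromaticNumber G k
  χG = proj₁ (proj₂ (proj₁ bad))

  exceeds : Exceeds k G
  exceeds = proj₂ (proj₂ (proj₁ bad))

  fewestVertices : ∀ {m′} (H : Graph m′) → Counterexample k H → suc m ≤ m′
  fewestVertices H = proj₁ (proj₂ bad) _ H

  noProperSubgraph : ∀ {m′} (H : Graph m′) → ProperSubgraph H G → ¬ Counterexample k H
  noProperSubgraph H = proj₂ (proj₂ bad) _ H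

  noLeaf : ∀ {z a} → adj G z a ≡ true → ¬ (∀ y → adj G z y ≡ true → y ≡ a)
  noLeaf {z} za leaf = 1+n≰n (fewestVertices H (deleteLeaf-connected G leaf connected , χH , exceedsH))
    where
    H = deleteVertex G z
    χH : HasChromaticNumber H k
    χH = hasChromaticNumber H (colourable-deleteVertex G z (proj₁ χG))
                              (proj₂ χG k₁ ≤-refl ∘ colourable-addLeaf G za leaf)
    exceedsH : Exceeds k H
    exceedsH = exceeds-transfer k₁ (chromPoly-deleteVertex-≤ k G za) (bound-suc (chromaticNumber≤size H χH))
                 (λ _ clique → inj₂ (twoCoreIsClique-addLeaf G z leaf clique)) exceeds

  anotherNeighbour : ∀ {v u} → adj G v u ≡ true → Σ (Fin (suc m)) λ w → adj G v w ≡ true × w ≢ u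
  anotherNeighbour {v} {u} vu with any? (λ w → (adj G v w ≟ᵇ true) ×-dec ¬? (w ≟ᶠ u))
  ... | yes found = found
  ... | no none   = ⊥-elim (noLeaf vu λ y vy → decidable-stable (y ≟ᶠ u) λ y≢u → none (y , vy , y≢u))

  connectedDeletion-colourable : ∀ {u v} → adj G u v ≡ true → Connected (deleteEdge G u v) →
                                 Colorable (deleteEdge G u v) k₁
  connectedDeletion-colourable {u} {v} uv connectedH with colourable? (deleteEdge G u v) k₁
  ... | yes colourable = colourable
  ... | no ¬colourable = ⊥-elim (noProperSubgraph H subgraph (connectedH , χH , exceedsH))
    where
    H = deleteEdge G u v
    k-colouring : Colorable H k
    k-colouring = let (c , proper) = proj₁ χG in c , proper-deleteEdge G proper
    χH = hasChromaticNumber H k-colouring ¬colourable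
    subgraph : ProperSubgraph H G
    subgraph = record { f = λ i → i ; f-inj = λ e → e ; edges = λ i j → deleteEdge-⊆ G
                      ; isProper = inj₂ (u , v , uv , deleteEdge-removes G) }
    open PeelingColourings H (proj₁ k-colouring) (proj₂ k-colouring) using (sameColour)
    PG<PH : TwoCoreIsClique H k → chromPoly G k < chromPoly H k
    PG<PH clique = let (c , proper , cu≡cv) = sameColour clique (adj⇒≢ G uv) (deleteEdge-removes G) in
      chromPoly-mono-< k {G} {H} (proper-deleteEdge G) c proper λ properG → properG u v uv cu≡cv
    exceedsH : Exceeds k H
    exceedsH = exceeds-transfer 1
                 (subst (chromPoly G k ≤_) (sym (*-identityˡ _)) (chromPoly-mono k {G} {H} (proper-deleteEdge G)))
                 (*-identityˡ _) (λ PH≡B → inj₁ ∘ subst (chromPoly G k <_) PH≡B ∘ PG<PH) exceeds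

  cut-colourable : ∀ {A} → Acc _⊃_ A → ∀ {u v} → Cut G A u v → ColourableOn G A k₁
  cut-colourable {A} (acc larger) {u} {v} cut with anotherNeighbour (trans (adj-sym G v u) (Cut.uv cut))
  ... | w , vw , w≢u = beyond (component (deleteEdge G v w) v)
    where
    open Cut cut
    beyond : Component (deleteEdge G v w) v → ColourableOn G A k₁
    beyond R with w ∈? Component.members R
    ... | yes w∈R =
      let (c , proper) = connectedDeletion-colourable vw
                           (deleteEdge-connected G connected (Component.reachable R w∈R))
      in c , λ i j i∈A j∈A ij → proper i j (deleteEdge-kept G ij (λ { refl → v∉A i∈A }) λ { refl → v∉A j∈A })
    ... | no w∉R  =
      let (c , proper) = cut-colourable (larger A⊂A∪R′) (cut-∪ G cut (component-cut G vw R w∉R) w≢u)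
      in c , properOn-⊆ G (p⊆p∪q R′) proper
      where
      R′ = Component.members R
      A⊂A∪R′ : A ⊂ A ∪ R′
      A⊂A∪R′ = p⊆p∪q R′ , v , q⊆p∪q A R′ (Component.root R) , v∉A

  edge-critical : ∀ {u v} → adj G u v ≡ true → Colorable (deleteEdge G u v) k₁
  edge-critical {u} {v} uv = split (component (deleteEdge G u v) u)
    where
    split : Component (deleteEdge G u v) u → Colorable (deleteEdge G u v) k₁
    split R with v ∈? Component.members R
    ... | yes v∈R =
      connectedDeletion-colourable uv (deleteEdge-connected G connected (Component.reachable R v∈R))
    ... | no v∉R  = colourable-glue (deleteEdge G u v) (Component.closed R) (side cut) (side (cut-∁ G cut))
      where
      cut = component-cut G uv R v∉R
      side : ∀ {A x y} → Cut G A x y → ColourableOn (deleteEdge G u v) A k₁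
      side cut = let (c , proper) = cut-colourable (⊃-wellFounded _) cut in c , properOn-deleteEdge G proper

  vertex-critical : ∀ z → Colorable (deleteVertex G z) k₁
  vertex-critical z =
    let (w , zw) = reach⇒neighbour (connected z (punchIn z other)) (punchInᵢ≢i z other ∘ sym)
        (d , proper) = edge-critical zw
    in d ∘ punchIn z ,
       λ i j ij → proper (punchIn z i) (punchIn z j) (deleteEdge-kept G ij (punchInᵢ≢i z i) (punchInᵢ≢i z j))
    where
    other : Fin m
    other = fromℕ< (≤-pred (≤-trans (s≤s (s≤s z≤n)) (chromaticNumber≤size G χG)))

  critical : Critical k G
  critical = χG , (λ z → chromaticBelow (deleteVertex G z) (vertex-critical z)) ,
             (λ u v uv → chromaticBelow (deleteEdge G u v) (edge-critical uv))

-- The assumed counterexample is redundant (a bad graph is one), and k ≥ 3 would suffice.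
lemma3 : (k : ℕ) → 4 ≤ k →
    Σ ℕ (λ m → Σ (Graph m) (λ H → Counterexample k H)) →
    ∀ n (G : Graph n) → Bad k G → Critical k G
lemma3 _ (s≤s (s≤s (s≤s (s≤s _)))) _ zero    G bad = proj₁ (proj₂ (proj₁ bad)) , _ , λ ()
lemma3 _ (s≤s (s≤s (s≤s (s≤s _)))) _ (suc m) G bad = BadGraph.critical G bad
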